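{- Let $p$ be a prime, $k\ge2$, $A=\mathbb{Z}_p^k$, and let $T$ be a caterpillar with spine path $s_1s_2s_3$, where $X,Y,Z$ are the sets of leaves attached to $s_1,s_2,s_3$ respectively and $|V(T)|=|A|$. Let $f$ be an $A$-rainbow labeling of $T$ with $f(s_1)=a$, $f(s_2)=0$, $f(s_3)=b$, where $b\in\langle a\rangle$. Let $C=u+\langle a\rangle$ be a coset of $\langle a\rangle$ different from $\langle a\rangle$. Then either $C$ is contained in exactly one of $f(X)$, $f(Y)$, $f(Z)$, or $C$ intersects each of $f(X)$, $f(Y)$, $f(Z)$.
   Context: For an Abelian group $A$ and a tree $T$ with $|V(T)|=|A|$, a labeling $f\colon V(T)\to A$ induces the edge labeling $uv\mapsto f(u)+f(v)$; $f$ is an $A$-rainbow labeling if $f$ is a bijection and all edges receive distinct labels. $\langle a\rangle$ denotes the subgroup generated by $a$. (In the paper's language: the cosets of $\langle\{a,0,b\}\rangle$ are the weakly connected components of the Cayley digraph $\mathrm{Cay}(A,\{a,0,b\})$; those not containing $0$ are the regular components, and each leaf label in $X$, $Y$, $Z$ is called $x$, $y$, $z$ respectively; the claim says a regular component contains all three letters or only one.) -}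

module Defs where

open import Data.Nat using (ℕ; zero; suc; NonZero) renaming (_+_ to _+ℕ_)
open import Data.Nat.DivMod using (_mod_)
open import Data.Fin using (Fin; toℕ)
open import Data.Vec using (Vec; zipWith; replicate)
open import Data.Product using (∃; _×_; _,_; proj₁; proj₂)
open import Relation.Binary.PropositionalEquality using (_≡_)

ℤpk : ℕ → ℕ → Set
ℤpk p k = Vec (Fin p) k

addℤp : (p : ℕ) .{{_ : NonZero p}} → Fin p → Fin p → Fin p
addℤp p x y = (toℕ x +ℕ toℕ y) mod p

addA : (p k : ℕ) .{{_ : NonZero p}} → ℤpk p k → ℤpk p k → ℤpk p k
addA p k = zipWith (addℤp p)

zeroA : (p k : ℕ) .{{_ : NonZero p}} → ℤpk p k
zeroA p k = replicate k (0 mod p)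

smul : (p k : ℕ) .{{_ : NonZero p}} → ℕ → ℤpk p k → ℤpk p k
smul p k zero a = zeroA p k
smul p k (suc m) a = addA p k a (smul p k m a)

InSpan : (p k : ℕ) .{{_ : NonZero p}} → ℤpk p k → ℤpk p k → Set
InSpan p k a b = ∃ λ m → b ≡ smul p k m a

-- Caterpillar with spine s₁ s₂ s₃ and leaf sets X (at s₁), Y (at s₂), Z (at s₃),
-- of sizes nx, ny, nz.
data Vert (nx ny nz : ℕ) : Set where
  s₁ s₂ s₃ : Vert nx ny nz
  leafX : Fin nx → Vert nx ny nz
  leafY : Fin ny → Vert nx ny nz
  leafZ : Fin nz → Vert nx ny nz

data Edge (nx ny nz : ℕ) : Set where
  e₁₂ e₂₃ : Edge nx ny nz
  eX : Fin nx → Edge nx ny nz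
  eY : Fin ny → Edge nx ny nz
  eZ : Fin nz → Edge nx ny nz

endpoints : {nx ny nz : ℕ} → Edge nx ny nz → Vert nx ny nz × Vert nx ny nz
endpoints e₁₂ = s₁ , s₂
endpoints e₂₃ = s₂ , s₃
endpoints (eX i) = s₁ , leafX i
endpoints (eY i) = s₂ , leafY i
endpoints (eZ i) = s₃ , leafZ i

open import Function.Definitions using (Injective; Bijective)

edgeLabel : (p k : ℕ) .{{_ : NonZero p}} {nx ny nz : ℕ} →
            (Vert nx ny nz → ℤpk p k) → Edge nx ny nz → ℤpk p k
edgeLabel p k f e = addA p k (f (proj₁ (endpoints e))) (f (proj₂ (endpoints e)))

Rainbow : (p k : ℕ) .{{_ : NonZero p}} {nx ny nz : ℕ} →
          (Vert nx ny nz → ℤpk p k) → Set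
Rainbow p k f = Bijective _≡_ _≡_ f × Injective _≡_ _≡_ (edgeLabel p k f)

-- Every element u + t·a of the coset C = u + ⟨a⟩ labels a leaf, since the spine labels a, 0
-- and b = m·a lie in ⟨a⟩. A leaf at s₁, s₂, s₃ labelled u + t·a has edge label u + (t+1)·a,
-- u + t·a, u + (t+m)·a, so rainbowness forbids an X-label at t with a Y-label at t+1, a
-- Z-label at t with a Y-label at t+m, and a Z-label at t with an X-label at t+m-1. If C
-- misses one of X, Y, Z it is covered by the other two, and the relevant exclusion makes one
-- of them closed under a step d ∈ {1, m-1, m}, nonzero mod p because b ∉ {0, a}. As p is
-- prime, such a step reaches every residue, so C lies in a single leaf set.

module Submission where

open import Algebra.Bundles using (CommutativeMonoid)
open import Algebra.Structures.Biased using (isCommutativeMonoidˡ)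
import Algebra.Properties.CommutativeMonoid.Mult as Mult
import Algebra.Properties.CommutativeSemigroup as CommutativeSemigroupProperties
open import Data.Empty using (⊥-elim)
open import Data.Fin using (Fin; toℕ)
open import Data.Fin.Properties using (toℕ-injective; toℕ-fromℕ<; toℕ<n; any?)
import Data.Fin.Properties as Fin
open import Data.Nat using (ℕ; zero; suc; pred; NonZero; ≢-nonZero; nonTrivial⇒n>1; _≤_; _+_; _*_; _^_)
open import Data.Nat.Coprimality using (prime⇒coprime; coprime-Bézout)
open import Data.Nat.DivMod
open import Data.Nat.Divisibility using (m∣m*n)
open import Data.Nat.GCD using (module Bézout)
open import Data.Nat.Primality using (Prime; prime⇒nonTrivial)
open import Data.Nat.Properties
open import Data.Nat.Tactic.RingSolver using (solve-∀)
open import Data.Product using (∃; ∃₂; _×_; _,_; proj₁; proj₂; uncurry)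
open import Data.Sum using (_⊎_; inj₁; inj₂; [_,_]′; fromInj₁; fromInj₂)
open import Data.Vec using ([]; _∷_)
open import Data.Vec.Properties using (zipWith-assoc; zipWith-comm; zipWith-identityˡ)
import Data.Vec.Properties as Vec
open import Function using (_∘_)
open import Level using (0ℓ)
open import Relation.Binary.PropositionalEquality
open import Relation.Nullary using (¬_; Dec; yes; no)
open import Relation.Nullary.Decidable using (map′)
open import Function.Definitions using (Injective; Surjective)

open import Defs

module _ {p : ℕ} .{{_ : NonZero p}} where

  %-cong-+ : ∀ {m m′ n n′} → m % p ≡ m′ % p → n % p ≡ n′ % p → (m + n) % p ≡ (m′ + n′) % p
  %-cong-+ {m} {m′} {n} {n′} m≡m′ n≡n′ = begin
    (m + n) % p             ≡⟨ %-distribˡ-+ m n p ⟩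
    (m % p + n % p) % p     ≡⟨ cong₂ (λ x y → (x + y) % p) m≡m′ n≡n′ ⟩
    (m′ % p + n′ % p) % p   ≡⟨ %-distribˡ-+ m′ n′ p ⟨
    (m′ + n′) % p           ∎
    where open ≡-Reasoning

  %-cong-* : ∀ {m m′ n n′} → m % p ≡ m′ % p → n % p ≡ n′ % p → (m * n) % p ≡ (m′ * n′) % p
  %-cong-* {m} {m′} {n} {n′} m≡m′ n≡n′ = begin
    (m * n) % p             ≡⟨ %-distribˡ-* m n p ⟩
    (m % p * (n % p)) % p   ≡⟨ cong₂ (λ x y → (x * y) % p) m≡m′ n≡n′ ⟩
    (m′ % p * (n′ % p)) % p ≡⟨ %-distribˡ-* m′ n′ p ⟨
    (m′ * n′) % p           ∎
    where open ≡-Reasoning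

  toℕ[n-mod-p]%p≡n%p : ∀ n → toℕ (n mod p) % p ≡ n % p
  toℕ[n-mod-p]%p≡n%p n = trans (cong (_% p) (toℕ-fromℕ< (m%n<n n p))) (m%n%n≡m%n n p)

  mod-cong : ∀ {m n} → m % p ≡ n % p → m mod p ≡ n mod p
  mod-cong {m} {n} m≡n = toℕ-injective (begin
    toℕ (m mod p) ≡⟨ toℕ-fromℕ< (m%n<n m p) ⟩
    m % p         ≡⟨ m≡n ⟩
    n % p         ≡⟨ toℕ-fromℕ< (m%n<n n p) ⟨
    toℕ (n mod p) ∎)
    where open ≡-Reasoning

  0%p≡0 : 0 % p ≡ 0
  0%p≡0 = m*n%n≡0 0 p

  n+pred[p]*n≡p*n : ∀ n → n + pred p * n ≡ p * n
  n+pred[p]*n≡p*n n = cong (_* n) (suc-pred p)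

  -- When Bézout gives 1 + y d ≡ x p, y d is congruent to -1, so pred p * y inverts d.
  mod-inverse : Prime p → ∀ {d} → d % p ≢ 0 → ∃ λ x → (x * d) % p ≡ 1 % p
  mod-inverse pr {d} d≢0 with coprime-Bézout (prime⇒coprime pr {{≢-nonZero d≢0}} (m%n<n d p))
  ... | Bézout.-+ x y 1+xp≡yd = y , (begin
    (y * d) % p         ≡⟨ %-cong-* {y} refl (sym (m%n%n≡m%n d p)) ⟩
    (y * (d % p)) % p   ≡⟨ cong (_% p) 1+xp≡yd ⟨
    (1 + x * p) % p     ≡⟨ [m+kn]%n≡m%n 1 x p ⟩
    1 % p               ∎)
    where open ≡-Reasoning
  ... | Bézout.+- x y 1+yd≡xp = pred p * y , (begin
    (pred p * y * d) % p           ≡⟨ %-cong-* {pred p * y} refl (sym (m%n%n≡m%n d p)) ⟩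
    (pred p * y * (d % p)) % p     ≡⟨ [m+n]%n≡m%n _ p ⟨
    (pred p * y * (d % p) + p) % p ≡⟨ cong (_% p) shifted ⟩
    (1 + pred p * x * p) % p       ≡⟨ [m+kn]%n≡m%n 1 (pred p * x) p ⟩
    1 % p                          ∎)
    where
    open ≡-Reasoning
    shifted : pred p * y * (d % p) + p ≡ 1 + pred p * x * p
    shifted = begin
      pred p * y * (d % p) + p             ≡⟨ cong (pred p * y * (d % p) +_) (suc-pred p) ⟨
      pred p * y * (d % p) + suc (pred p)  ≡⟨ regroup (pred p) y (d % p) ⟩
      1 + pred p * (1 + y * (d % p))       ≡⟨ cong (λ v → 1 + pred p * v) 1+yd≡xp ⟩
      1 + pred p * (x * p)                 ≡⟨ cong suc (*-assoc (pred p) x p) ⟨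
      1 + pred p * x * p                   ∎
      where
      regroup : ∀ q y e → q * y * e + suc q ≡ 1 + q * (1 + y * e)
      regroup = solve-∀

  reach-by-multiples : Prime p → ∀ {d} → d % p ≢ 0 → ∀ t s → ∃ λ j → (t + j * d) % p ≡ s % p
  reach-by-multiples pr {d} d≢0 t s with mod-inverse pr d≢0
  ... | x , xd≡1 = x * r , (begin
    (t + x * r * d) % p      ≡⟨ %-cong-+ {t} refl multiple≡r ⟩
    (t + r) % p              ≡⟨ cong (_% p) (+-assoc t (pred p * t) s) ⟨
    (t + pred p * t + s) % p ≡⟨ cong (λ v → (v + s) % p) (n+pred[p]*n≡p*n t) ⟩
    (p * t + s) % p          ≡⟨ %-remove-+ˡ s (m∣m*n t) ⟩
    s % p                    ∎)
    where
    open ≡-Reasoning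
    r = pred p * t + s
    multiple≡r : (x * r * d) % p ≡ r % p
    multiple≡r = begin
      (x * r * d) % p   ≡⟨ cong (_% p) (trans (cong (_* d) (*-comm x r)) (*-assoc r x d)) ⟩
      (r * (x * d)) % p ≡⟨ %-cong-* {r} refl xd≡1 ⟩
      (r * 1) % p       ≡⟨ cong (_% p) (*-identityʳ r) ⟩
      r % p             ∎

  ModInvariant : (ℕ → Set) → Set
  ModInvariant P = ∀ {t s} → t % p ≡ s % p → P t → P s

  iterate-step : ∀ {P : ℕ → Set} {d} → (∀ {t} → P t → P (t + d)) →
                 ∀ {t} → P t → ∀ j → P (t + j * d)
  iterate-step {P} {d} step {t} Pt zero = subst P (sym (+-identityʳ t)) Pt
  iterate-step {P} {d} step {t} Pt (suc j) =
    subst P (trans (+-assoc t (j * d) d) (cong (t +_) (+-comm (j * d) d))) (step (iterate-step {P} step Pt j))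

  spread : Prime p → ∀ {P : ℕ → Set} {d} → d % p ≢ 0 → ModInvariant P →
           (∀ {t} → P t → P (t + d)) → ∀ {t} → P t → ∀ s → P s
  spread pr {P} d≢0 invariant step {t} Pt s with reach-by-multiples pr d≢0 t s
  ... | j , t+jd≡s = invariant t+jd≡s (iterate-step {P} step Pt j)

  -- Covering and blocking make K closed under + d, so K is everything once inhabited.
  dichotomy : Prime p → ∀ {K L : ℕ → Set} {d} → d % p ≢ 0 → ModInvariant K →
              (∀ t → K t ⊎ L t) → (∀ {t} → K t → ¬ L t) → (∀ {t} → K t → ¬ L (t + d)) →
              (∀ t → K t) ⊎ (∀ t → L t)
  dichotomy pr {K} {L} {d} d≢0 invariant cover disjoint blocked =
    [ inj₁ ∘ everywhere
    , (λ L0 → inj₂ λ t → fromInj₂ (λ Kt → ⊥-elim (disjoint (everywhere Kt 0) L0)) (cover t))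
    ]′ (cover 0)
    where
    everywhere : ∀ {t} → K t → ∀ s → K s
    everywhere = spread pr d≢0 invariant (λ {t} Kt → fromInj₁ (⊥-elim ∘ blocked Kt) (cover (t + d)))

  addℤp-comm : ∀ x y → addℤp p x y ≡ addℤp p y x
  addℤp-comm x y = cong (_mod p) (+-comm (toℕ x) (toℕ y))

  addℤp-assoc : ∀ x y z → addℤp p (addℤp p x y) z ≡ addℤp p x (addℤp p y z)
  addℤp-assoc x y z = mod-cong (begin
    (toℕ (addℤp p x y) + toℕ z) % p ≡⟨ %-cong-+ (toℕ[n-mod-p]%p≡n%p _) refl ⟩
    (toℕ x + toℕ y + toℕ z) % p     ≡⟨ cong (_% p) (+-assoc (toℕ x) (toℕ y) (toℕ z)) ⟩
    (toℕ x + (toℕ y + toℕ z)) % p   ≡⟨ %-cong-+ {toℕ x} refl (toℕ[n-mod-p]%p≡n%p _) ⟨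
    (toℕ x + toℕ (addℤp p y z)) % p ∎)
    where open ≡-Reasoning

  addℤp-identityˡ : ∀ x → addℤp p (0 mod p) x ≡ x
  addℤp-identityˡ x = toℕ-injective (begin
    toℕ (addℤp p (0 mod p) x)     ≡⟨ toℕ-fromℕ< (m%n<n _ p) ⟩
    (toℕ (0 mod p) + toℕ x) % p   ≡⟨ %-cong-+ {m′ = 0} (toℕ[n-mod-p]%p≡n%p 0) refl ⟩
    toℕ x % p                     ≡⟨ m<n⇒m%n≡m (toℕ<n x) ⟩
    toℕ x                         ∎)
    where open ≡-Reasoning

  ℤpk-+-commutativeMonoid : ℕ → CommutativeMonoid 0ℓ 0ℓ
  ℤpk-+-commutativeMonoid k = record
    { Carrier             = ℤpk p k
    ; _≈_                 = _≡_
    ; _∙_                 = addA p k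
    ; ε                   = zeroA p k
    ; isCommutativeMonoid = isCommutativeMonoidˡ record
      { isSemigroup = record
        { isMagma = record { isEquivalence = isEquivalence ; ∙-cong = cong₂ (addA p k) }
        ; assoc   = zipWith-assoc addℤp-assoc
        }
      ; identityˡ = zipWith-identityˡ addℤp-identityˡ
      ; comm      = zipWith-comm addℤp-comm
      }
    }

  smul-[] : ∀ n → smul p 0 n [] ≡ []
  smul-[] zero    = refl
  smul-[] (suc n) rewrite smul-[] n = refl

  smul-∷ : ∀ {k} n x (xs : ℤpk p k) → smul p (suc k) n (x ∷ xs) ≡ (n * toℕ x) mod p ∷ smul p k n xs
  smul-∷ zero    x xs = refl
  smul-∷ (suc n) x xs rewrite smul-∷ n x xs =
    cong (_∷ addA p _ xs (smul p _ n xs)) (mod-cong (%-cong-+ {toℕ x} refl (toℕ[n-mod-p]%p≡n%p _)))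

  smul-p≡zero : ∀ {k} (a : ℤpk p k) → smul p k p a ≡ zeroA p k
  smul-p≡zero []       = smul-[] p
  smul-p≡zero (x ∷ xs) =
    trans (smul-∷ p x xs) (cong₂ _∷_ (mod-cong (%-remove-+ʳ 0 (m∣m*n (toℕ x)))) (smul-p≡zero xs))

module ℤpk (p k : ℕ) .{{_ : NonZero p}} where

  open CommutativeMonoid (ℤpk-+-commutativeMonoid {p} k) public
    using (_∙_; ε; identityʳ; assoc; commutativeSemigroup)
  open Mult (ℤpk-+-commutativeMonoid {p} k) public using (×-homo-1; ×-homo-+; ×-assocˡ)
    renaming (_×_ to _·_)
  open CommutativeSemigroupProperties commutativeSemigroup public using (x∙yz≈y∙xz)

  smul≡· : ∀ n a → smul p k n a ≡ n · a
  smul≡· zero    a = refl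
  smul≡· (suc n) a = cong (a ∙_) (smul≡· n a)

  p·a≡ε : ∀ a → p · a ≡ ε
  p·a≡ε a = trans (sym (smul≡· p a)) (smul-p≡zero a)

  ·-mod : ∀ n a → (n % p) · a ≡ n · a
  ·-mod n a = begin
    (n % p) · a                          ≡⟨ identityʳ _ ⟨
    (n % p) · a ∙ ε                      ≡⟨ cong ((n % p) · a ∙_) (p·a≡ε ((n / p) · a)) ⟨
    (n % p) · a ∙ p · ((n / p) · a)      ≡⟨ cong ((n % p) · a ∙_) (×-assocˡ a p (n / p)) ⟩
    (n % p) · a ∙ (p * (n / p)) · a      ≡⟨ ×-homo-+ a (n % p) (p * (n / p)) ⟨
    (n % p + p * (n / p)) · a            ≡⟨ cong (λ v → (n % p + v) · a) (*-comm p (n / p)) ⟩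
    (n % p + n / p * p) · a              ≡⟨ cong (_· a) (m≡m%n+[m/n]*n n p) ⟨
    n · a                                ∎
    where open ≡-Reasoning

  ·-cong-mod : ∀ {m n} a → m % p ≡ n % p → m · a ≡ n · a
  ·-cong-mod {m} {n} a m≡n = trans (sym (·-mod m a)) (trans (cong (_· a) m≡n) (·-mod n a))

module Caterpillar
    (p k : ℕ) .{{_ : NonZero p}} (pr : Prime p) {nx ny nz : ℕ}
    (f : Vert nx ny nz → ℤpk p k)
    (f-injective : Injective _≡_ _≡_ f) (f-surjective : Surjective _≡_ _≡_ f)
    (edge-injective : Injective _≡_ _≡_ (edgeLabel p k f))
    (a : ℤpk p k) (m : ℕ)
    (f[s₁]≡a : f s₁ ≡ a) (f[s₂]≡0 : f s₂ ≡ zeroA p k) (f[s₃]≡b : f s₃ ≡ smul p k m a)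
    (u : ℤpk p k) (u∉⟨a⟩ : ¬ InSpan p k a u) where

  open ℤpk p k

  f[s₁]≡1·a : f s₁ ≡ 1 · a
  f[s₁]≡1·a = trans f[s₁]≡a (sym (×-homo-1 a))

  f[s₂]≡0·a : f s₂ ≡ 0 · a
  f[s₂]≡0·a = f[s₂]≡0

  f[s₃]≡m·a : f s₃ ≡ m · a
  f[s₃]≡m·a = trans f[s₃]≡b (smul≡· m a)

  coset : ℕ → ℤpk p k
  coset t = u ∙ t · a

  coset-cong-mod : ∀ {t s} → t % p ≡ s % p → coset t ≡ coset s
  coset-cong-mod t≡s = cong (u ∙_) (·-cong-mod a t≡s)

  coset-shift : ∀ δ t → δ · a ∙ coset t ≡ coset (t + δ)
  coset-shift δ t = begin
    δ · a ∙ (u ∙ t · a) ≡⟨ x∙yz≈y∙xz (δ · a) u (t · a) ⟩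
    u ∙ (δ · a ∙ t · a) ≡⟨ cong (u ∙_) (×-homo-+ a δ t) ⟨
    u ∙ (δ + t) · a     ≡⟨ cong (λ n → u ∙ n · a) (+-comm δ t) ⟩
    u ∙ (t + δ) · a     ∎
    where open ≡-Reasoning

  -- (pred p * t)·a is the inverse of t·a.
  coset∉⟨a⟩ : ∀ t n → coset t ≢ n · a
  coset∉⟨a⟩ t n coset≡n·a = u∉⟨a⟩ (n + pred p * t , trans u≡ (sym (smul≡· (n + pred p * t) a)))
    where
    open ≡-Reasoning
    u≡ : u ≡ (n + pred p * t) · a
    u≡ = begin
      u                                 ≡⟨ identityʳ u ⟨
      u ∙ 0 · a                         ≡⟨ cong (u ∙_) (·-cong-mod a (%-remove-+ʳ 0 (m∣m*n t))) ⟨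
      u ∙ (p * t) · a                   ≡⟨ cong (λ v → u ∙ v · a) (n+pred[p]*n≡p*n t) ⟨
      u ∙ (t + pred p * t) · a          ≡⟨ cong (u ∙_) (×-homo-+ a t (pred p * t)) ⟩
      u ∙ (t · a ∙ (pred p * t) · a)    ≡⟨ assoc u (t · a) _ ⟨
      coset t ∙ (pred p * t) · a        ≡⟨ cong (_∙ (pred p * t) · a) coset≡n·a ⟩
      n · a ∙ (pred p * t) · a          ≡⟨ ×-homo-+ a n (pred p * t) ⟨
      (n + pred p * t) · a              ∎

  -- A record rather than a Σ-type, so that t can be inferred from the type.
  record Labelled {n} (L : Fin n → Vert nx ny nz) (t : ℕ) : Set where
    constructor labelled
    field
      leaf          : Fin n
      f[leaf]≡coset : f (L leaf) ≡ coset t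

  labelled-invariant : ∀ {n} (L : Fin n → Vert nx ny nz) → ModInvariant (Labelled L)
  labelled-invariant L t≡s (labelled i f[Li]≡) = labelled i (trans f[Li]≡ (coset-cong-mod t≡s))

  labelled? : ∀ {n} (L : Fin n → Vert nx ny nz) t → Dec (Labelled L t)
  labelled? L t = map′ (λ (i , f[Li]≡) → labelled i f[Li]≡) (λ (labelled i f[Li]≡) → i , f[Li]≡)
                       (any? λ i → Vec.≡-dec Fin._≟_ (f (L i)) (coset t))

  meets? : ∀ {n} (L : Fin n → Vert nx ny nz) → Dec (∃ (Labelled L))
  meets? L = map′ (λ (r , Lr) → toℕ r , Lr)
                  (λ (t , Lt) → t mod p , labelled-invariant L (sym (toℕ[n-mod-p]%p≡n%p t)) Lt)
                  (any? λ r → labelled? L (toℕ r))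

  labelled-disjoint : ∀ {n n′} {L : Fin n → Vert nx ny nz} {L′ : Fin n′ → Vert nx ny nz} →
                      (∀ i j → L i ≢ L′ j) → ∀ {t} → Labelled L t → ¬ Labelled L′ t
  labelled-disjoint L≢L′ (labelled i f[Li]≡) (labelled j f[L′j]≡) =
    L≢L′ i j (f-injective (trans f[Li]≡ (sym f[L′j]≡)))

  leaf-trichotomy : ∀ t → Labelled leafX t ⊎ Labelled leafY t ⊎ Labelled leafZ t
  leaf-trichotomy t = place (proj₁ (f-surjective (coset t))) (proj₂ (f-surjective (coset t)) refl)
    where
    place : ∀ v → f v ≡ coset t → Labelled leafX t ⊎ Labelled leafY t ⊎ Labelled leafZ t
    place s₁        f[v]≡ = ⊥-elim (coset∉⟨a⟩ t 1 (trans (sym f[v]≡) f[s₁]≡1·a))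
    place s₂        f[v]≡ = ⊥-elim (coset∉⟨a⟩ t 0 (trans (sym f[v]≡) f[s₂]≡0·a))
    place s₃        f[v]≡ = ⊥-elim (coset∉⟨a⟩ t m (trans (sym f[v]≡) f[s₃]≡m·a))
    place (leafX i) f[v]≡ = inj₁ (labelled i f[v]≡)
    place (leafY i) f[v]≡ = inj₂ (inj₁ (labelled i f[v]≡))
    place (leafZ i) f[v]≡ = inj₂ (inj₂ (labelled i f[v]≡))

  leaf-edges-collide : ∀ {e e′} δ t δ′ t′ →
    f (proj₁ (endpoints e)) ≡ δ · a → f (proj₂ (endpoints e)) ≡ coset t →
    f (proj₁ (endpoints e′)) ≡ δ′ · a → f (proj₂ (endpoints e′)) ≡ coset t′ →
    t + δ ≡ t′ + δ′ → e ≡ e′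
  leaf-edges-collide {e} {e′} δ t δ′ t′ f[s] f[v] f[s′] f[v′] t+δ≡t′+δ′ = edge-injective (begin
    edgeLabel p k f e   ≡⟨ cong₂ _∙_ f[s] f[v] ⟩
    δ · a ∙ coset t     ≡⟨ coset-shift δ t ⟩
    coset (t + δ)       ≡⟨ cong coset t+δ≡t′+δ′ ⟩
    coset (t′ + δ′)     ≡⟨ coset-shift δ′ t′ ⟨
    δ′ · a ∙ coset t′   ≡⟨ cong₂ _∙_ f[s′] f[v′] ⟨
    edgeLabel p k f e′  ∎)
    where open ≡-Reasoning

  m%p≢0 : m % p ≢ 0
  m%p≢0 m%p≡0
    with f-injective (trans f[s₃]≡m·a (trans (·-cong-mod a (trans m%p≡0 (sym 0%p≡0))) (sym f[s₂]≡0·a)))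
  ... | ()

  m%p≢1 : m % p ≢ 1 % p
  m%p≢1 m≡1 with f-injective (trans f[s₃]≡m·a (trans (·-cong-mod a m≡1) (sym f[s₁]≡1·a)))
  ... | ()

  m≢0 : m ≢ 0
  m≢0 m≡0 = m%p≢0 (trans (cong (_% p) m≡0) 0%p≡0)

  1+pred[m]≡m : suc (pred m) ≡ m
  1+pred[m]≡m = suc-pred m {{≢-nonZero m≢0}}

  pred[m]%p≢0 : pred m % p ≢ 0
  pred[m]%p≢0 pred[m]%p≡0 = m%p≢1 (begin
    m % p              ≡⟨ cong (_% p) 1+pred[m]≡m ⟨
    (1 + pred m) % p   ≡⟨ %-cong-+ {m = 1} refl (trans pred[m]%p≡0 (sym 0%p≡0)) ⟩
    (1 + 0) % p        ∎)
    where open ≡-Reasoning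

  1%p≢0 : 1 % p ≢ 0
  1%p≢0 = subst (_≢ 0) (sym (m<n⇒m%n≡m (nonTrivial⇒n>1 p {{prime⇒nonTrivial pr}}))) (λ ())

  X-blocks-Y : ∀ {t} → Labelled leafX t → ¬ Labelled leafY (t + 1)
  X-blocks-Y {t} (labelled i f[Xi]≡) (labelled j f[Yj]≡)
    with leaf-edges-collide {eX i} {eY j} 1 t 0 (t + 1) f[s₁]≡1·a f[Xi]≡ f[s₂]≡0·a f[Yj]≡
                            (sym (+-identityʳ (t + 1)))
  ... | ()

  Z-blocks-Y : ∀ {t} → Labelled leafZ t → ¬ Labelled leafY (t + m)
  Z-blocks-Y {t} (labelled i f[Zi]≡) (labelled j f[Yj]≡)
    with leaf-edges-collide {eZ i} {eY j} m t 0 (t + m) f[s₃]≡m·a f[Zi]≡ f[s₂]≡0·a f[Yj]≡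
                            (sym (+-identityʳ (t + m)))
  ... | ()

  Z-blocks-X : ∀ {t} → Labelled leafZ t → ¬ Labelled leafX (t + pred m)
  Z-blocks-X {t} (labelled i f[Zi]≡) (labelled j f[Xj]≡)
    with leaf-edges-collide {eZ i} {eX j} m t 1 (t + pred m) f[s₃]≡m·a f[Zi]≡ f[s₁]≡1·a f[Xj]≡
                            t+m≡t+pred[m]+1
    where
    t+m≡t+pred[m]+1 : t + m ≡ t + pred m + 1
    t+m≡t+pred[m]+1 = trans (cong (t +_) (trans (sym 1+pred[m]≡m) (+-comm 1 (pred m))))
                            (sym (+-assoc t (pred m) 1))
  ... | ()

  InCoset : ℤpk p k → Set
  InCoset c = ∃ λ n → c ≡ addA p k u (smul p k n a)

  CosetWithin : ∀ {n} → (Fin n → Vert nx ny nz) → Set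
  CosetWithin L = ∀ c → InCoset c → ∃ λ i → f (L i) ≡ c

  CosetMeets : ∀ {n} → (Fin n → Vert nx ny nz) → Set
  CosetMeets L = ∃₂ λ c i → InCoset c × f (L i) ≡ c

  Placement : Set
  Placement = ((CosetWithin leafX × ¬ CosetWithin leafY × ¬ CosetWithin leafZ)
               ⊎ (¬ CosetWithin leafX × CosetWithin leafY × ¬ CosetWithin leafZ)
               ⊎ (¬ CosetWithin leafX × ¬ CosetWithin leafY × CosetWithin leafZ))
              ⊎ (CosetMeets leafX × CosetMeets leafY × CosetMeets leafZ)

  cover⇒within : ∀ {n} {L : Fin n → Vert nx ny nz} → (∀ t → Labelled L t) → CosetWithin L
  cover⇒within cover c (t , c≡) with cover t
  ... | labelled i f[Li]≡ = i , trans f[Li]≡ (trans (cong (u ∙_) (sym (smul≡· t a))) (sym c≡))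

  cover⇒¬within : ∀ {n n′} {L : Fin n → Vert nx ny nz} {L′ : Fin n′ → Vert nx ny nz} →
                  (∀ i j → L i ≢ L′ j) → (∀ t → Labelled L t) → ¬ CosetWithin L′
  cover⇒¬within L≢L′ cover within =
    labelled-disjoint L≢L′ (cover 0) (uncurry labelled (within (coset 0) (0 , refl)))

  labelled⇒meets : ∀ {n} {L : Fin n → Vert nx ny nz} {t} → Labelled L t → CosetMeets L
  labelled⇒meets {t = t} (labelled i f[Li]≡) = coset t , i , (t , cong (u ∙_) (sym (smul≡· t a))) , f[Li]≡

  only-X : (∀ t → Labelled leafX t) → Placement
  only-X cover =
    inj₁ (inj₁ (cover⇒within cover ,
                cover⇒¬within (λ _ _ ()) cover ,
                cover⇒¬within (λ _ _ ()) cover))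

  only-Y : (∀ t → Labelled leafY t) → Placement
  only-Y cover =
    inj₁ (inj₂ (inj₁ (cover⇒¬within (λ _ _ ()) cover ,
                      cover⇒within cover ,
                      cover⇒¬within (λ _ _ ()) cover)))

  only-Z : (∀ t → Labelled leafZ t) → Placement
  only-Z cover =
    inj₁ (inj₂ (inj₂ (cover⇒¬within (λ _ _ ()) cover ,
                      cover⇒¬within (λ _ _ ()) cover ,
                      cover⇒within cover)))

  placement-without-Z : ¬ ∃ (Labelled leafZ) → Placement
  placement-without-Z no-Z =
    [ only-X , only-Y ]′ 
      (dichotomy pr 1%p≢0 (labelled-invariant leafX) X-or-Y (labelled-disjoint (λ _ _ ())) X-blocks-Y)
    where
    X-or-Y : ∀ t → Labelled leafX t ⊎ Labelled leafY t
    X-or-Y t with leaf-trichotomy t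
    ... | inj₁ X          = inj₁ X
    ... | inj₂ (inj₁ Y)   = inj₂ Y
    ... | inj₂ (inj₂ Z)   = ⊥-elim (no-Z (t , Z))

  placement-without-Y : ¬ ∃ (Labelled leafY) → Placement
  placement-without-Y no-Y =
    [ only-Z , only-X ]′ 
      (dichotomy pr pred[m]%p≢0 (labelled-invariant leafZ) Z-or-X (labelled-disjoint (λ _ _ ())) Z-blocks-X)
    where
    Z-or-X : ∀ t → Labelled leafZ t ⊎ Labelled leafX t
    Z-or-X t with leaf-trichotomy t
    ... | inj₁ X          = inj₂ X
    ... | inj₂ (inj₁ Y)   = ⊥-elim (no-Y (t , Y))
    ... | inj₂ (inj₂ Z)   = inj₁ Z

  placement-without-X : ¬ ∃ (Labelled leafX) → Placement
  placement-without-X no-X =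
    [ only-Z , only-Y ]′ 
      (dichotomy pr m%p≢0 (labelled-invariant leafZ) Z-or-Y (labelled-disjoint (λ _ _ ())) Z-blocks-Y)
    where
    Z-or-Y : ∀ t → Labelled leafZ t ⊎ Labelled leafY t
    Z-or-Y t with leaf-trichotomy t
    ... | inj₁ X          = ⊥-elim (no-X (t , X))
    ... | inj₂ (inj₁ Y)   = inj₂ Y
    ... | inj₂ (inj₂ Z)   = inj₁ Z

  placement : Placement
  placement with meets? leafZ | meets? leafY | meets? leafX
  ... | no no-Z | _       | _       = placement-without-Z no-Z
  ... | yes _   | no no-Y | _       = placement-without-Y no-Y
  ... | yes _   | yes _   | no no-X = placement-without-X no-X
  ... | yes (_ , Z) | yes (_ , Y) | yes (_ , X) =
    inj₂ (labelled⇒meets X , labelled⇒meets Y , labelled⇒meets Z)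

lemma4 : (p k : ℕ) .{{_ : NonZero p}} → Prime p → 2 ≤ k →
         (nx ny nz : ℕ) → 3 + (nx + ny + nz) ≡ p ^ k →
         (f : Vert nx ny nz → ℤpk p k) → Rainbow p k f →
         (a b : ℤpk p k) → f s₁ ≡ a → f s₂ ≡ zeroA p k → f s₃ ≡ b →
         InSpan p k a b →
         (u : ℤpk p k) → ¬ InSpan p k a u →
         let C∋ : ℤpk p k → Set
             C∋ c = ∃ λ m → c ≡ addA p k u (smul p k m a)
             ⊆X = ∀ c → C∋ c → ∃ λ i → f (leafX i) ≡ c
             ⊆Y = ∀ c → C∋ c → ∃ λ i → f (leafY i) ≡ c
             ⊆Z = ∀ c → C∋ c → ∃ λ i → f (leafZ i) ≡ c
             meetsX = ∃₂ λ c i → C∋ c × f (leafX i) ≡ c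
             meetsY = ∃₂ λ c i → C∋ c × f (leafY i) ≡ c
             meetsZ = ∃₂ λ c i → C∋ c × f (leafZ i) ≡ c
         in ((⊆X × ¬ ⊆Y × ¬ ⊆Z) ⊎ (¬ ⊆X × ⊆Y × ¬ ⊆Z) ⊎ (¬ ⊆X × ¬ ⊆Y × ⊆Z))
            ⊎ (meetsX × meetsY × meetsZ)
lemma4 p k pr _ nx ny nz _ f ((f-injective , f-surjective) , edge-injective)
       a b f[s₁]≡a f[s₂]≡0 f[s₃]≡b (m , b≡m·a) u u∉⟨a⟩ =
  Caterpillar.placement p k pr f f-injective f-surjective edge-injective
                        a m f[s₁]≡a f[s₂]≡0 (trans f[s₃]≡b b≡m·a) u u∉⟨a⟩
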